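{- Let $q\leqslant p$. If $t\to_q u$ then $t\to_p u$ or $t$ has the form $\mathbb{E}[\mathsf{f}\,\overline{m}]$ for some $m\in \mathrm{dom}(q)\setminus \mathrm{dom}(p)$.
   Context: A condition $p$ is (the graph of) a finite partial function from $\mathbb{N}$ to $\{\mathsf{0},\mathsf{1}\}$; $q\leqslant p$ means $p\subseteq q$. The term language is that of Martin-Löf type theory with $\mathsf{N},\mathsf{N}_0,\mathsf{N}_1,\mathsf{N}_2$, $\Pi$, $\Sigma$, a universe, recursors $\mathsf{rec}_{\mathsf{N}_0},\mathsf{rec}_{\mathsf{N}_1},\mathsf{rec}_{\mathsf{N}_2},\mathsf{rec}_{\mathsf{N}}$, extended with a constant $\mathsf{f}$ (a generic point $\mathsf{N}\to\mathsf{N}_2$); $\overline{n}$ denotes $\mathsf{S}^n\,\mathsf{0}$. Evaluation contexts are $\mathbb{E} ::= [\;] \mid \mathbb{E}\,u \mid \mathbb{E}.1 \mid \mathbb{E}.2 \mid \mathsf{S}\,\mathbb{E} \mid \mathsf{f}\,\mathbb{E} \mid \mathsf{rec}_{\mathsf{N}_0}(\lambda x.C)\,\mathbb{E} \mid \mathsf{rec}_{\mathsf{N}_1}(\lambda x.C)\,a\,\mathbb{E} \mid \mathsf{rec}_{\mathsf{N}_2}(\lambda x.C)\,a_0\,a_1\,\mathbb{E} \mid \mathsf{rec}_{\mathsf{N}}(\lambda x.C)\,c_z\,g\,\mathbb{E}$. The unannotated one-step reduction $e\to e'$ consists of the $\beta$-rule, the projection rules $(u,v).1\to u$, $(u,v).2\to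 v$, and the $\iota$-rules for the recursors applied to $\mathsf{0}$, $\mathsf{1}$ or $\mathsf{S}\,\overline{k}$. The reduction $t\to_p u$ at condition $p$ is defined inductively: if $e\to e'$ then $e\to_p e'$; if $k\in\mathrm{dom}(p)$ then $\mathsf{f}\,\overline{k}\to_p p(k)$; and if $e\to_p e'$ then $\mathbb{E}[e]\to_p\mathbb{E}[e']$. -}

module Defs where

open import Data.Nat using (ℕ; zero; suc; _≤_)
open import Data.Bool using (Bool; true; false)
open import Data.Maybe using (Maybe; just; nothing)
open import Data.Product using (Σ; ∃; _×_; _,_)
open import Relation.Binary.PropositionalEquality using (_≡_)

-- Raw terms (de Bruijn indices).  Binders: the codomain of Π and Σ,
-- the body of λ, and the motive (λx.C) of each recursor.

data Tm : Set where
  var   : ℕ → Tm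
  U     : Tm
  N N₀ N₁ N₂ : Tm
  Π Σ'  : Tm → Tm → Tm
  lam   : Tm → Tm
  app   : Tm → Tm → Tm
  pair  : Tm → Tm → Tm
  fst snd : Tm → Tm
  O     : Tm                     -- 0  (of N, N₁ and N₂)
  I     : Tm                     -- 1  (of N₂)
  S     : Tm → Tm
  f     : Tm                     -- generic point N → N₂
  recN₀ : Tm → Tm → Tm                       -- rec (λx.C) e      ; C binds
  recN₁ : Tm → Tm → Tm → Tm                  -- rec (λx.C) a e
  recN₂ : Tm → Tm → Tm → Tm → Tm             -- rec (λx.C) a₀ a₁ e
  recN  : Tm → Tm → Tm → Tm → Tm             -- rec (λx.C) c_z g e

num : ℕ → Tm
num zero    = O
num (suc n) = S (num n)

ext : (ℕ → ℕ) → ℕ → ℕ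
ext ρ zero    = zero
ext ρ (suc n) = suc (ρ n)

ren : (ℕ → ℕ) → Tm → Tm
ren ρ (var x) = var (ρ x)
ren ρ U = U
ren ρ N = N
ren ρ N₀ = N₀
ren ρ N₁ = N₁
ren ρ N₂ = N₂
ren ρ (Π A B) = Π (ren ρ A) (ren (ext ρ) B)
ren ρ (Σ' A B) = Σ' (ren ρ A) (ren (ext ρ) B)
ren ρ (lam t) = lam (ren (ext ρ) t)
ren ρ (app t u) = app (ren ρ t) (ren ρ u)
ren ρ (pair t u) = pair (ren ρ t) (ren ρ u)
ren ρ (fst t) = fst (ren ρ t)
ren ρ (snd t) = snd (ren ρ t)
ren ρ O = O
ren ρ I = I
ren ρ (S t) = S (ren ρ t)
ren ρ f = f
ren ρ (recN₀ C e) = recN₀ (ren (ext ρ) C) (ren ρ e)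
ren ρ (recN₁ C a e) = recN₁ (ren (ext ρ) C) (ren ρ a) (ren ρ e)
ren ρ (recN₂ C a b e) = recN₂ (ren (ext ρ) C) (ren ρ a) (ren ρ b) (ren ρ e)
ren ρ (recN C z g e) = recN (ren (ext ρ) C) (ren ρ z) (ren ρ g) (ren ρ e)

exts : (ℕ → Tm) → ℕ → Tm
exts σ zero    = var zero
exts σ (suc n) = ren suc (σ n)

sub : (ℕ → Tm) → Tm → Tm
sub σ (var x) = σ x
sub σ U = U
sub σ N = N
sub σ N₀ = N₀
sub σ N₁ = N₁
sub σ N₂ = N₂
sub σ (Π A B) = Π (sub σ A) (sub (exts σ) B)
sub σ (Σ' A B) = Σ' (sub σ A) (sub (exts σ) B)
sub σ (lam t) = lam (sub (exts σ) t)
sub σ (app t u) = app (sub σ t) (sub σ u)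
sub σ (pair t u) = pair (sub σ t) (sub σ u)
sub σ (fst t) = fst (sub σ t)
sub σ (snd t) = snd (sub σ t)
sub σ O = O
sub σ I = I
sub σ (S t) = S (sub σ t)
sub σ f = f
sub σ (recN₀ C e) = recN₀ (sub (exts σ) C) (sub σ e)
sub σ (recN₁ C a e) = recN₁ (sub (exts σ) C) (sub σ a) (sub σ e)
sub σ (recN₂ C a b e) = recN₂ (sub (exts σ) C) (sub σ a) (sub σ b) (sub σ e)
sub σ (recN C z g e) = recN (sub (exts σ) C) (sub σ z) (sub σ g) (sub σ e)

single : Tm → ℕ → Tm
single u zero    = u
single u (suc n) = var n

_[_] : Tm → Tm → Tm
t [ u ] = sub (single u) t

data _⟶_ : Tm → Tm → Set where
  β     : ∀ {t u} → app (lam t) u ⟶ (t [ u ])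
  π₁    : ∀ {u v} → fst (pair u v) ⟶ u
  π₂    : ∀ {u v} → snd (pair u v) ⟶ v
  ιN₁   : ∀ {C a} → recN₁ C a O ⟶ a
  ιN₂⁰  : ∀ {C a₀ a₁} → recN₂ C a₀ a₁ O ⟶ a₀
  ιN₂¹  : ∀ {C a₀ a₁} → recN₂ C a₀ a₁ I ⟶ a₁
  ιN⁰   : ∀ {C z g} → recN C z g O ⟶ z
  ιNˢ   : ∀ {C z g} k →
          recN C z g (S (num k)) ⟶ app (app g (num k)) (recN C z g (num k))

data ECtx : Set where
  hole   : ECtx
  appL   : ECtx → Tm → ECtx
  fstE   : ECtx → ECtx
  sndE   : ECtx → ECtx
  SE     : ECtx → ECtx
  fE     : ECtx → ECtx
  recN₀E : Tm → ECtx → ECtx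
  recN₁E : Tm → Tm → ECtx → ECtx
  recN₂E : Tm → Tm → Tm → ECtx → ECtx
  recNE  : Tm → Tm → Tm → ECtx → ECtx

plug : ECtx → Tm → Tm
plug hole e = e
plug (appL E u) e = app (plug E e) u
plug (fstE E) e = fst (plug E e)
plug (sndE E) e = snd (plug E e)
plug (SE E) e = S (plug E e)
plug (fE E) e = app f (plug E e)
plug (recN₀E C E) e = recN₀ C (plug E e)
plug (recN₁E C a E) e = recN₁ C a (plug E e)
plug (recN₂E C a₀ a₁ E) e = recN₂ C a₀ a₁ (plug E e)
plug (recNE C z g E) e = recN C z g (plug E e)

record Cond : Set where
  field
    look   : ℕ → Maybe Bool
    finite : ∃ λ B → ∀ k → B ≤ k → look k ≡ nothing
open Cond public

_∈dom_ : ℕ → Cond → Set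
k ∈dom p = ∃ λ b → look p k ≡ just b

_⩽_ : Cond → Cond → Set
q ⩽ p = ∀ k b → look p k ≡ just b → look q k ≡ just b

bit : Bool → Tm
bit false = O
bit true  = I

data _⟶[_]_ : Tm → Cond → Tm → Set where
  head : ∀ {p e e'} → e ⟶ e' → e ⟶[ p ] e'
  gen  : ∀ {p k b} → look p k ≡ just b → app f (num k) ⟶[ p ] bit b
  ctx  : ∀ {p e e'} (E : ECtx) → e ⟶[ p ] e' → plug E e ⟶[ p ] plug E e'

module Submission where

open import Defs
open import Data.Nat using (ℕ)
open import Data.Maybe using (just; nothing)
open import Data.Maybe.Properties using (just-injective)
open import Data.Product using (Σ; _×_; _,_)
open import Data.Sum using (_⊎_; inj₁; inj₂)
open import Relation.Nullary using (¬_)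
open import Relation.Binary.PropositionalEquality using (_≡_; refl; trans; sym; cong)

infixr 9 _∘ᴱ_

_∘ᴱ_ : ECtx → ECtx → ECtx
hole             ∘ᴱ E' = E'
appL E u         ∘ᴱ E' = appL (E ∘ᴱ E') u
fstE E           ∘ᴱ E' = fstE (E ∘ᴱ E')
sndE E           ∘ᴱ E' = sndE (E ∘ᴱ E')
SE E             ∘ᴱ E' = SE (E ∘ᴱ E')
fE E             ∘ᴱ E' = fE (E ∘ᴱ E')
recN₀E C E       ∘ᴱ E' = recN₀E C (E ∘ᴱ E')
recN₁E C a E     ∘ᴱ E' = recN₁E C a (E ∘ᴱ E')
recN₂E C a₀ a₁ E ∘ᴱ E' = recN₂E C a₀ a₁ (E ∘ᴱ E')
recNE C z g E    ∘ᴱ E' = recNE C z g (E ∘ᴱ E')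

plug-∘ᴱ : ∀ E E' e → plug E (plug E' e) ≡ plug (E ∘ᴱ E') e
plug-∘ᴱ hole               E' e = refl
plug-∘ᴱ (appL E u)         E' e = cong (λ t → app t u) (plug-∘ᴱ E E' e)
plug-∘ᴱ (fstE E)           E' e = cong fst (plug-∘ᴱ E E' e)
plug-∘ᴱ (sndE E)           E' e = cong snd (plug-∘ᴱ E E' e)
plug-∘ᴱ (SE E)             E' e = cong S (plug-∘ᴱ E E' e)
plug-∘ᴱ (fE E)             E' e = cong (app f) (plug-∘ᴱ E E' e)
plug-∘ᴱ (recN₀E C E)       E' e = cong (recN₀ C) (plug-∘ᴱ E E' e)
plug-∘ᴱ (recN₁E C a E)     E' e = cong (recN₁ C a) (plug-∘ᴱ E E' e)
plug-∘ᴱ (recN₂E C a₀ a₁ E) E' e = cong (recN₂ C a₀ a₁) (plug-∘ᴱ E E' e)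
plug-∘ᴱ (recNE C z g E)    E' e = cong (recN C z g) (plug-∘ᴱ E E' e)

GenericRedexOutside : Cond → Cond → Tm → Set
GenericRedexOutside q p t =
  Σ ECtx (λ E → Σ ℕ (λ m → (t ≡ plug E (app f (num m))) × (m ∈dom q) × ¬ (m ∈dom p)))

plug-GenericRedexOutside : ∀ {q p t} (E : ECtx) →
  GenericRedexOutside q p t → GenericRedexOutside q p (plug E t)
plug-GenericRedexOutside E (E' , m , refl , m∈q , m∉p) =
  E ∘ᴱ E' , m , plug-∘ᴱ E E' _ , m∈q , m∉p

⩽-look-just : ∀ {p q} → q ⩽ p → ∀ {k b} → look q k ≡ just b →
  look p k ≡ just b ⊎ ¬ (k ∈dom p)
⩽-look-just {p} q⩽p {k} qk≡b with look p k in pk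
... | nothing = inj₂ λ { (_ , ()) }
... | just c with just-injective (trans (sym (q⩽p k c pk)) qk≡b)
...   | refl = inj₁ refl

lemma2p2 : (p q : Cond) → q ⩽ p → (t u : Tm) → t ⟶[ q ] u →
    (t ⟶[ p ] u) ⊎
    Σ ECtx (λ E → Σ ℕ (λ m → (t ≡ plug E (app f (num m))) × (m ∈dom q) × ¬ (m ∈dom p)))
lemma2p2 p q q⩽p _ _ (head r) = inj₁ (head r)
lemma2p2 p q q⩽p _ _ (gen {k = k} {b = b} qk≡b) with ⩽-look-just {p} {q} q⩽p qk≡b
... | inj₁ pk≡b = inj₁ (gen pk≡b)
... | inj₂ k∉p  = inj₂ (hole , k , refl , (b , qk≡b) , k∉p)
lemma2p2 p q q⩽p _ _ (ctx {e = e} {e' = e'} E r) with lemma2p2 p q q⩽p e e' r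
... | inj₁ r′      = inj₁ (ctx E r′)
... | inj₂ blocked = inj₂ (plug-GenericRedexOutside {q} {p} E blocked)
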